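{- Let $\mathcal{A}$ be a finite structure with domain $A$ and $U,X\subseteq A$. Then $\mathcal{A}$ has $\forall U$-$\exists X$-relativisation if and only if its complement $\overline{\mathcal{A}}$ has $\forall X$-$\exists U$-relativisation.
   Context: Structures are finite relational structures with nonempty domain. $\{\exists,\forall,\wedge,\vee\}\text{ -FO}$ is the set of first-order sentences built from relational atoms (no equality, no negation) using $\wedge,\vee,\exists,\forall$. The complement $\overline{\mathcal{A}}$ has domain $A$ and $R^{\overline{\mathcal{A}}}=A^a\setminus R^{\mathcal{A}}$ for each $a$-ary $R$. For a sentence $\varphi$, $\varphi_{[\forall u/\forall u\in U]}$ relativises every universal quantifier to $U$, $\varphi_{[\exists x/\exists x\in X]}$ relativises every existential quantifier to $X$, and $\varphi_{[\forall u/\forall u\in U,\exists x/\exists x\in X]}$ does both. A structure $\mathcal{A}$ has $\forall U$-$\exists X$-relativisation if for every sentence $\varphi$ of $\{\exists,\forall,\wedge,\vee\}\text{ -FO}$ the statements $\mathcal{A}\models\varphi$, $\mathcal{A}\models\varphi_{[\forall u/\forall u\in U]}$, $\mathcal{A}\models\varphi_{[\exists x/\exists x\in X]}$ and $\mathcal{A}\models\varphi_{[\forall u/\forall u\in U,\exists x/\exists x\in X]}$ are all equivalent. -}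

module Defs where

open import Data.Nat using (ℕ; suc)
open import Data.Fin using (Fin)
open import Data.Fin.Subset using (Subset; _∈_)
open import Data.Bool using (Bool; T; not)
open import Data.Product using (Σ; _×_)
open import Data.Sum using (_⊎_)
open import Data.Unit using (⊤)
open import Function using (_⇔_)

record Signature : Set where
  field
    nsym : ℕ
    ar   : Fin nsym → ℕ
open Signature public

record Structure (σ : Signature) : Set where
  field
    size : ℕ                       -- domain is Fin (suc size), nonempty
    rel  : (R : Fin (nsym σ)) → (Fin (ar σ R) → Fin (suc size)) → Bool
open Structure public

Dom : ∀ {σ} → Structure σ → Set
Dom 𝒜 = Fin (suc (size 𝒜))

complement : ∀ {σ} → Structure σ → Structure σ
complement 𝒜 = record { size = size 𝒜 ; rel = λ R t → not (rel 𝒜 R t) }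

-- {∃,∀,∧,∨}-FO formulas with m free variables (de Bruijn), no equality/negation.
data Formula (σ : Signature) : ℕ → Set where
  atom : ∀ {m} (R : Fin (nsym σ)) → (Fin (ar σ R) → Fin m) → Formula σ m
  _∧'_ : ∀ {m} → Formula σ m → Formula σ m → Formula σ m
  _∨'_ : ∀ {m} → Formula σ m → Formula σ m → Formula σ m
  ∃'   : ∀ {m} → Formula σ (suc m) → Formula σ m
  ∀'   : ∀ {m} → Formula σ (suc m) → Formula σ m

Sentence : Signature → Set
Sentence σ = Formula σ 0

extend : ∀ {m} {D : Set} → (Fin m → D) → D → Fin (suc m) → D
extend ρ d Fin.zero    = d
extend ρ d (Fin.suc i) = ρ i

-- With QA = QE = everything this is ordinary satisfaction; relativising
-- ∀ to U / ∃ to X corresponds to QA = (_∈ U) / QE = (_∈ X).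
Sat : ∀ {σ} (𝒜 : Structure σ) (QA QE : Dom 𝒜 → Set) {m} →
      Formula σ m → (Fin m → Dom 𝒜) → Set
Sat 𝒜 QA QE (atom R t) ρ = T (rel 𝒜 R (λ i → ρ (t i)))
Sat 𝒜 QA QE (φ ∧' ψ)   ρ = Sat 𝒜 QA QE φ ρ × Sat 𝒜 QA QE ψ ρ
Sat 𝒜 QA QE (φ ∨' ψ)   ρ = Sat 𝒜 QA QE φ ρ ⊎ Sat 𝒜 QA QE ψ ρ
Sat 𝒜 QA QE (∃' φ)     ρ = Σ (Dom 𝒜) λ d → QE d × Sat 𝒜 QA QE φ (extend ρ d)
Sat 𝒜 QA QE (∀' φ)     ρ = (d : Dom 𝒜) → QA d → Sat 𝒜 QA QE φ (extend ρ d)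

private
  empty : ∀ {D : Set} → Fin 0 → D
  empty ()

Models : ∀ {σ} (𝒜 : Structure σ) (QA QE : Dom 𝒜 → Set) → Sentence σ → Set
Models 𝒜 QA QE φ = Sat 𝒜 QA QE φ empty

All : ∀ {D : Set} → D → Set
All _ = ⊤

HasRelativisation : ∀ {σ} (𝒜 : Structure σ) (U X : Subset (suc (size 𝒜))) → Set
HasRelativisation 𝒜 U X = (φ : Sentence _) →
    (Models 𝒜 All All φ ⇔ Models 𝒜 (_∈ U) All φ)
  × (Models 𝒜 All All φ ⇔ Models 𝒜 All (_∈ X) φ)
  × (Models 𝒜 All All φ ⇔ Models 𝒜 (_∈ U) (_∈ X) φ)

-- Pushing a negation through a sentence of {∃,∀,∧,∨}-FO swaps ∧/∨ and ∃/∀ and leaves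
-- negated atoms, which are atoms of the complement. Hence φ holds in the complement with
-- ∀ relativised to X and ∃ to U iff its dual fails in 𝒜 with ∀ relativised to U and ∃
-- to X. As dual is an involution on sentences, each relativisation equivalence for one
-- structure is the negation of one for the other. Over a finite domain satisfaction is
-- decidable, which is what makes the negation reversible.
module Submission where

open import Defs
open import Data.Nat using (ℕ; suc)
open import Data.Fin using (Fin)
open import Data.Fin.Properties using (all?; any?; ¬∀⟶∃¬)
open import Data.Fin.Subset using (Subset)
open import Data.Fin.Subset.Properties using (_∈?_)
open import Data.Bool using (Bool; true; false; T; not)
open import Data.Product using (_,_; proj₁; proj₂)
open import Data.Sum using (inj₁; inj₂)
open import Data.Unit using (tt)
open import Function using (_⇔_; mk⇔; Equivalence; _∘_)
open import Function.Properties.Equivalence using () renaming (sym to ⇔-sym; trans to ⇔-trans)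
open import Function.Related.TypeIsomorphisms using (¬-cong-⇔)
open import Relation.Binary.PropositionalEquality using (_≡_; refl; cong; cong₂; subst)
open import Relation.Nullary using (Dec; yes; no; ¬_; contradiction)
open import Relation.Nullary.Decidable using (T?; _×-dec_; _⊎-dec_; _→-dec_; decidable-stable)
open import Relation.Unary using (Decidable)

dual : ∀ {σ m} → Formula σ m → Formula σ m
dual (atom R t) = atom R t
dual (φ ∧' ψ)   = dual φ ∨' dual ψ
dual (φ ∨' ψ)   = dual φ ∧' dual ψ
dual (∃' φ)     = ∀' (dual φ)
dual (∀' φ)     = ∃' (dual φ)

dual-involutive : ∀ {σ m} (φ : Formula σ m) → dual (dual φ) ≡ φ
dual-involutive (atom R t) = refl
dual-involutive (φ ∧' ψ)   = cong₂ _∧'_ (dual-involutive φ) (dual-involutive ψ)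
dual-involutive (φ ∨' ψ)   = cong₂ _∨'_ (dual-involutive φ) (dual-involutive ψ)
dual-involutive (∃' φ)     = cong ∃' (dual-involutive φ)
dual-involutive (∀' φ)     = cong ∀' (dual-involutive φ)

T-not : ∀ b → T (not b) ⇔ (¬ T b)
T-not true  = mk⇔ (λ ()) (λ ¬tt → ¬tt tt)
T-not false = mk⇔ (λ _ ()) (λ _ → tt)

module _ {σ} (𝒜 : Structure σ) {QA QE : Dom 𝒜 → Set} (QA? : Decidable QA) (QE? : Decidable QE) where

  sat? : ∀ {m} (φ : Formula σ m) ρ → Dec (Sat 𝒜 QA QE φ ρ)
  sat? (atom R t) ρ = T? _
  sat? (φ ∧' ψ)   ρ = sat? φ ρ ×-dec sat? ψ ρ
  sat? (φ ∨' ψ)   ρ = sat? φ ρ ⊎-dec sat? ψ ρ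
  sat? (∃' φ)     ρ = any? λ d → QE? d ×-dec sat? φ (extend ρ d)
  sat? (∀' φ)     ρ = all? λ d → QA? d →-dec sat? φ (extend ρ d)

module _ {σ} (𝒜 : Structure σ) {QA QE : Dom 𝒜 → Set} where

  sat-complement⇒¬sat-dual : ∀ {m} (φ : Formula σ m) ρ →
    Sat (complement 𝒜) QA QE φ ρ → ¬ Sat 𝒜 QE QA (dual φ) ρ
  sat-complement⇒¬sat-dual (atom R t) ρ s = Equivalence.to (T-not _) s
  sat-complement⇒¬sat-dual (φ ∧' ψ) ρ (s , _) (inj₁ d) = sat-complement⇒¬sat-dual φ ρ s d
  sat-complement⇒¬sat-dual (φ ∧' ψ) ρ (_ , s) (inj₂ d) = sat-complement⇒¬sat-dual ψ ρ s d
  sat-complement⇒¬sat-dual (φ ∨' ψ) ρ (inj₁ s) (d , _) = sat-complement⇒¬sat-dual φ ρ s d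
  sat-complement⇒¬sat-dual (φ ∨' ψ) ρ (inj₂ s) (_ , d) = sat-complement⇒¬sat-dual ψ ρ s d
  sat-complement⇒¬sat-dual (∃' φ) ρ (a , qa , s) d = sat-complement⇒¬sat-dual φ (extend ρ a) s (d a qa)
  sat-complement⇒¬sat-dual (∀' φ) ρ s (a , qa , d) = sat-complement⇒¬sat-dual φ (extend ρ a) (s a qa) d

  module _ (QA? : Decidable QA) (QE? : Decidable QE) where

    ¬sat-dual⇒sat-complement : ∀ {m} (φ : Formula σ m) ρ →
      ¬ Sat 𝒜 QE QA (dual φ) ρ → Sat (complement 𝒜) QA QE φ ρ
    ¬sat-dual⇒sat-complement (atom R t) ρ ¬s = Equivalence.from (T-not _) ¬s
    ¬sat-dual⇒sat-complement (φ ∧' ψ) ρ ¬s =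
      ¬sat-dual⇒sat-complement φ ρ (¬s ∘ inj₁) , ¬sat-dual⇒sat-complement ψ ρ (¬s ∘ inj₂)
    ¬sat-dual⇒sat-complement (φ ∨' ψ) ρ ¬s with sat? 𝒜 QE? QA? (dual φ) ρ
    ... | yes s = inj₂ (¬sat-dual⇒sat-complement ψ ρ (λ t → ¬s (s , t)))
    ... | no ¬t = inj₁ (¬sat-dual⇒sat-complement φ ρ ¬t)
    ¬sat-dual⇒sat-complement (∃' φ) ρ ¬s
      with ¬∀⟶∃¬ _ _ (λ a → QE? a →-dec sat? 𝒜 QE? QA? (dual φ) (extend ρ a)) (λ s → ¬s s)
    ... | a , ¬s-a with QE? a
    ...   | yes qa = a , qa , ¬sat-dual⇒sat-complement φ (extend ρ a) (λ s → ¬s-a (λ _ → s))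
    ...   | no ¬qa = contradiction (λ qa → contradiction qa ¬qa) ¬s-a
    ¬sat-dual⇒sat-complement (∀' φ) ρ ¬s a qa =
      ¬sat-dual⇒sat-complement φ (extend ρ a) (λ s → ¬s (a , qa , s))

    sat-complement⇔¬sat-dual : ∀ {m} (φ : Formula σ m) ρ →
      Sat (complement 𝒜) QA QE φ ρ ⇔ (¬ Sat 𝒜 QE QA (dual φ) ρ)
    sat-complement⇔¬sat-dual φ ρ =
      mk⇔ (sat-complement⇒¬sat-dual φ ρ) (¬sat-dual⇒sat-complement φ ρ)

sat⇔¬sat-complement-dual : ∀ {σ} (𝒜 : Structure σ) {QA QE : Dom 𝒜 → Set} →
  Decidable QA → Decidable QE → ∀ {m} (φ : Formula σ m) ρ →
  Sat 𝒜 QA QE φ ρ ⇔ (¬ Sat (complement 𝒜) QE QA (dual φ) ρ)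
sat⇔¬sat-complement-dual 𝒜 {QA} {QE} QA? QE? φ ρ = ⇔-sym (⇔-trans ¬sat-complement ¬¬sat)
  where
  ¬sat-complement : (¬ Sat (complement 𝒜) QE QA (dual φ) ρ) ⇔ (¬ ¬ Sat 𝒜 QA QE φ ρ)
  ¬sat-complement = ¬-cong-⇔ (subst (λ ψ → Sat (complement 𝒜) QE QA (dual φ) ρ ⇔ (¬ Sat 𝒜 QA QE ψ ρ))
                                    (dual-involutive φ)
                                    (sat-complement⇔¬sat-dual 𝒜 QE? QA? (dual φ) ρ))
  ¬¬sat : (¬ ¬ Sat 𝒜 QA QE φ ρ) ⇔ Sat 𝒜 QA QE φ ρ
  ¬¬sat = mk⇔ (decidable-stable (sat? 𝒜 QA? QE? φ ρ)) (λ s ¬s → ¬s s)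

Interpretation : Signature → ℕ → Set
Interpretation σ n = (R : Fin (nsym σ)) → (Fin (ar σ R) → Fin (suc n)) → Bool

structure : ∀ {σ} n → Interpretation σ n → Structure σ
structure n r = record { size = n ; rel = r }

All? : ∀ {D : Set} → Decidable (All {D})
All? _ = yes tt

relativisation-transfer : ∀ {σ n} (r s : Interpretation σ n) →
  (∀ {QA QE} → Decidable QA → Decidable QE → ∀ φ →
     Models (structure n s) QA QE φ ⇔ (¬ Models (structure n r) QE QA (dual φ))) →
  ∀ U X → HasRelativisation (structure n r) U X → HasRelativisation (structure n s) X U
relativisation-transfer r s duality U X rel-r φ =
    negate (_∈? X) All? (proj₁ (proj₂ (rel-r (dual φ))))
  , negate All? (_∈? U) (proj₁ (rel-r (dual φ)))
  , negate (_∈? X) (_∈? U) (proj₂ (proj₂ (rel-r (dual φ))))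
  where
  negate : ∀ {QA QE} → Decidable QA → Decidable QE →
    Models (structure _ r) All All (dual φ) ⇔ Models (structure _ r) QE QA (dual φ) →
    Models (structure _ s) All All φ ⇔ Models (structure _ s) QA QE φ
  negate QA? QE? e =
    ⇔-trans (duality All? All? φ) (⇔-trans (¬-cong-⇔ e) (⇔-sym (duality QA? QE? φ)))

proposition5 : ∀ {σ : Signature} (𝒜 : Structure σ) (U X : Subset (suc (size 𝒜))) →
    HasRelativisation 𝒜 U X ⇔ HasRelativisation (complement 𝒜) X U
proposition5 𝒜 U X = mk⇔
  (relativisation-transfer (rel 𝒜) (rel (complement 𝒜))
     (λ QA? QE? φ → sat-complement⇔¬sat-dual 𝒜 QA? QE? φ _) U X)
  (relativisation-transfer (rel (complement 𝒜)) (rel 𝒜)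
     (λ QA? QE? φ → sat⇔¬sat-complement-dual 𝒜 QA? QE? φ _) X U)
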